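{- Let $G$ be a graph and $X$ an $\operatorname{IR}(G)$-set. Weakly partition $X$ into sets $Y$ and $Z$ (either may be empty) such that every vertex of $Z$ is isolated in $G[X]$ and every $y\in Y$ has at least one external private neighbour, i.e. $\operatorname{EPN}(y,X)\neq\varnothing$. For each $y\in Y$ choose $y'\in\operatorname{EPN}(y,X)$, let $Y'=\{y':y\in Y\}$ and $X'=(X-Y)\cup Y'$. Then $X'$ is an $\operatorname{IR}(G)$-set.
   Context: All graphs are finite and simple. For $D\subseteq V(G)$ and $v\in D$, $\operatorname{PN}(v,D)=N[v]-N[D-\{v\}]$ (closed neighbourhoods), and $\operatorname{EPN}(v,D)=\operatorname{PN}(v,D)-D$ is the set of external $D$-private neighbours of $v$ (vertices outside $D$ adjacent to $v$ and to no other vertex of $D$). $D$ is irredundant if $\operatorname{PN}(v,D)\neq\varnothing$ for all $v\in D$; $\operatorname{IR}(G)$ is the maximum size of an irredundant set, and an $\operatorname{IR}(G)$-set is an irredundant set of size $\operatorname{IR}(G)$. The set $X'$ in the statement is called a flip-set of $X$ (using $Y'$). -}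

module Defs where

open import Data.Nat using (ℕ; _≤_)
open import Data.Bool using (Bool; T; false)
open import Data.Fin using (Fin)
open import Data.Fin.Subset using (Subset; _∈_; _∉_; ∣_∣)
open import Data.Product using (Σ; ∃; _×_; _,_)
open import Data.Sum using (_⊎_)
open import Relation.Nullary using (¬_)
open import Relation.Binary.PropositionalEquality using (_≡_; _≢_)

record Graph (n : ℕ) : Set where
  field
    adj   : Fin n → Fin n → Bool
    sym   : ∀ u v → adj u v ≡ adj v u
    irrefl : ∀ v → adj v v ≡ false

open Graph public

module _ {n : ℕ} (G : Graph n) where

  Adj : Fin n → Fin n → Set
  Adj u v = T (adj G u v)

  InClosedNbhd : Fin n → Fin n → Set
  InClosedNbhd w v = w ≡ v ⊎ Adj v w

  InPN : Fin n → Subset n → Fin n → Set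
  InPN v D w = InClosedNbhd w v × (∀ u → u ∈ D → u ≢ v → ¬ InClosedNbhd w u)

  InEPN : Fin n → Subset n → Fin n → Set
  InEPN v D w = InPN v D w × w ∉ D

  Irredundant : Subset n → Set
  Irredundant D = ∀ v → v ∈ D → ∃ λ w → InPN v D w

  IRSet : Subset n → Set
  IRSet D = Irredundant D × (∀ D′ → Irredundant D′ → ∣ D′ ∣ ≤ ∣ D ∣)

--  * X′ is irredundant: a vertex v ∈ X - Y is its own private neighbour in
--    X′ (it has no neighbour in X, and a neighbour f y ∈ X′ would put v in
--    N[f y], contradicting that f y is private to y), while y is a private
--    neighbour of f y in X′ for the symmetric reason.
--  * ∣ X ∣ ≤ ∣ X′ ∣: the map "y ↦ f y on Y, identity elsewhere" sends X
--    injectively into X′, since distinct members of X have distinct private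
--    neighbours and f y ∉ X.  As X is maximum, so is X′.
module Submission where

open import Defs hiding (sym)
open import Data.Nat using (ℕ; zero; suc; _≤_; z≤n; s≤s)
import Data.Nat.Properties as Nat
open Nat using (module ≤-Reasoning)
open import Data.Bool using (T)
open import Data.Fin using (Fin; zero; suc)
open import Data.Fin.Properties using (_≟_)
open import Data.Fin.Subset using (Subset; _∈_; _∉_; ∣_∣; _-_; inside; outside; Nonempty; ⁅_⁆)
open import Data.Fin.Subset.Properties
  using (_∈?_; p─⊥≡p; p─q⊆p; x∈p∧x≢y⇒x∈p-y; nonempty?; Empty-unique; ∣⊥∣≡0)
open import Data.Vec using (_∷_)
open import Data.Vec.Base using (_[_]=_)
open _[_]=_
open import Data.Product using (∃; _×_; _,_; proj₁; proj₂)
open import Data.Sum using (_⊎_; inj₁; inj₂)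
open import Data.Empty using (⊥-elim)
open import Function.Bundles using (_⇔_; Equivalence)
open import Relation.Nullary using (¬_; yes; no)
open import Relation.Binary.PropositionalEquality
  using (_≡_; _≢_; refl; sym; trans; cong; subst)

∣p-x∣+1≡∣p∣ : ∀ {n} {x : Fin n} (p : Subset n) → x ∈ p → suc ∣ p - x ∣ ≡ ∣ p ∣
∣p-x∣+1≡∣p∣ (inside ∷ p) here = cong suc (cong ∣_∣ (p─⊥≡p p))
∣p-x∣+1≡∣p∣ (inside ∷ p) (there x∈p) = cong suc (∣p-x∣+1≡∣p∣ p x∈p)
∣p-x∣+1≡∣p∣ (outside ∷ p) (there x∈p) = ∣p-x∣+1≡∣p∣ p x∈p

x∈p-y⇒x∈p : ∀ {n} {x y : Fin n} {p : Subset n} → x ∈ p - y → x ∈ p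
x∈p-y⇒x∈p {y = y} {p} = p─q⊆p p ⁅ y ⁆

x∈p-y⇒x≢y : ∀ {n} {x y : Fin n} (p : Subset n) → x ∈ p - y → x ≢ y
x∈p-y⇒x≢y {y = zero}  (s ∷ p) (there x∈p-y) ()
x∈p-y⇒x≢y {y = suc y} (s ∷ p) (there x∈p-y) refl = x∈p-y⇒x≢y p x∈p-y refl

nonempty : ∀ {n} {k} (p : Subset n) → ∣ p ∣ ≡ suc k → Nonempty p
nonempty {n} p ∣p∣≡1+k with nonempty? p
... | yes ne = ne
... | no empty with () ← trans (sym ∣p∣≡1+k) (trans (cong ∣_∣ (Empty-unique empty)) (∣⊥∣≡0 n))

-- Counting by injection, by induction on k = ∣ A ∣: remove a member x of A
-- and its image g x from B; g still maps A - x injectively into B - g x.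
injection-size-by : ∀ {m n} k (A : Subset m) (B : Subset n) (g : Fin m → Fin n)
  → ∣ A ∣ ≡ k
  → (∀ {a} → a ∈ A → g a ∈ B)
  → (∀ {a b} → a ∈ A → b ∈ A → g a ≡ g b → a ≡ b)
  → ∣ A ∣ ≤ ∣ B ∣
injection-size-by zero A B g ∣A∣≡0 _ _ rewrite ∣A∣≡0 = z≤n
injection-size-by (suc k) A B g ∣A∣≡1+k maps inj = begin
  ∣ A ∣              ≡⟨ sym (∣p-x∣+1≡∣p∣ A x∈A) ⟩
  suc ∣ A - x ∣      ≤⟨ s≤s smaller ⟩
  suc ∣ B - g x ∣    ≡⟨ ∣p-x∣+1≡∣p∣ B (maps x∈A) ⟩
  ∣ B ∣              ∎
  where
  open ≤-Reasoning
  x = proj₁ (nonempty A ∣A∣≡1+k)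
  x∈A = proj₂ (nonempty A ∣A∣≡1+k)
  smaller : ∣ A - x ∣ ≤ ∣ B - g x ∣
  smaller = injection-size-by k (A - x) (B - g x) g
    (Nat.suc-injective (trans (∣p-x∣+1≡∣p∣ A x∈A) ∣A∣≡1+k))
    (λ {a} a∈A-x → x∈p∧x≢y⇒x∈p-y (maps (x∈p-y⇒x∈p a∈A-x))
                     (λ ga≡gx → x∈p-y⇒x≢y A a∈A-x (inj (x∈p-y⇒x∈p a∈A-x) x∈A ga≡gx)))
    (λ a∈ b∈ → inj (x∈p-y⇒x∈p a∈) (x∈p-y⇒x∈p b∈))

injection-size : ∀ {m n} (A : Subset m) (B : Subset n) (g : Fin m → Fin n)
  → (∀ {a} → a ∈ A → g a ∈ B)
  → (∀ {a b} → a ∈ A → b ∈ A → g a ≡ g b → a ≡ b)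
  → ∣ A ∣ ≤ ∣ B ∣
injection-size A B g = injection-size-by ∣ A ∣ A B g refl

module _ {n : ℕ} (G : Graph n) where

  IsolatedIn : Subset n → Fin n → Set
  IsolatedIn D v = ∀ {x} → x ∈ D → ¬ Adj G v x

  Adj-sym : ∀ {u w} → Adj G u w → Adj G w u
  Adj-sym {u} {w} = subst T (Graph.sym G u w)

  closedNbhd-sym : ∀ {u w} → InClosedNbhd G w u → InClosedNbhd G u w
  closedNbhd-sym (inj₁ w≡u) = inj₁ (sym w≡u)
  closedNbhd-sym (inj₂ uw)  = inj₂ (Adj-sym uw)

  -- An external private neighbour of a member v of D is a neighbour of v:
  -- it lies in N[v] but, being outside D, differs from v.
  EPN⇒Adj : ∀ {D v w} → v ∈ D → InEPN G v D w → Adj G v w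
  EPN⇒Adj {D} v∈D ((inj₁ w≡v , _) , w∉D) = ⊥-elim (w∉D (subst (_∈ D) (sym w≡v) v∈D))
  EPN⇒Adj _   ((inj₂ vw , _) , _)    = vw

  PN-unique : ∀ {D u v w} → u ∈ D → InPN G v D w → InClosedNbhd G w u → u ≡ v
  PN-unique {u = u} {v} u∈D (_ , unshared) w∈N[u] with u ≟ v
  ... | yes u≡v = u≡v
  ... | no  u≢v = ⊥-elim (unshared u u∈D u≢v w∈N[u])

  IRSet-of-size≥ : ∀ {X X′} → IRSet G X → Irredundant G X′ → ∣ X ∣ ≤ ∣ X′ ∣ → IRSet G X′
  IRSet-of-size≥ (_ , X-max) X′-irr ∣X∣≤∣X′∣ =
    X′-irr , λ D D-irr → Nat.≤-trans (X-max D D-irr) ∣X∣≤∣X′∣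

module Flip {n : ℕ} (G : Graph n) (X Y : Subset n) (f : Fin n → Fin n)
  (Y⊆X : ∀ {y} → y ∈ Y → y ∈ X)
  (rest-isolated : ∀ {v} → v ∈ X → v ∉ Y → IsolatedIn G X v)
  (f-EPN : ∀ {y} → y ∈ Y → InEPN G y X (f y))
  (X′ : Subset n)
  (X′-members : ∀ w → w ∈ X′ ⇔ ((w ∈ X × w ∉ Y) ⊎ (∃ λ y → y ∈ Y × f y ≡ w)))
  where

  f-adj : ∀ {y} → y ∈ Y → Adj G y (f y)
  f-adj y∈Y = EPN⇒Adj G (Y⊆X y∈Y) (f-EPN y∈Y)

  f-outside : ∀ {y} → y ∈ Y → f y ∉ X
  f-outside y∈Y = proj₂ (f-EPN y∈Y)

  f-private : ∀ {y u} → y ∈ Y → u ∈ X → InClosedNbhd G (f y) u → u ≡ y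
  f-private y∈Y u∈X = PN-unique G u∈X (proj₁ (f-EPN y∈Y))

  kept-self-private : ∀ {v} → v ∈ X → v ∉ Y → InPN G v X′ v
  kept-self-private {v} v∈X v∉Y = inj₁ refl , unshared
    where
    unshared : ∀ u → u ∈ X′ → u ≢ v → ¬ InClosedNbhd G v u
    unshared u _ u≢v (inj₁ v≡u) = u≢v (sym v≡u)
    unshared u u∈X′ _ (inj₂ uv) with Equivalence.to (X′-members u) u∈X′
    ... | inj₁ (u∈X , _) = rest-isolated v∈X v∉Y u∈X (Adj-sym G uv)
    ... | inj₂ (y , y∈Y , refl) =
      v∉Y (subst (_∈ Y) (sym (f-private y∈Y v∈X (closedNbhd-sym G (inj₂ uv)))) y∈Y)

  source-private : ∀ {y} → y ∈ Y → InPN G (f y) X′ y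
  source-private {y} y∈Y = closedNbhd-sym G (inj₂ (f-adj y∈Y)) , unshared
    where
    unshared : ∀ u → u ∈ X′ → u ≢ f y → ¬ InClosedNbhd G y u
    unshared u u∈X′ u≢fy y∈N[u] with Equivalence.to (X′-members u) u∈X′
    unshared u _ _ (inj₁ y≡u) | inj₁ (_ , u∉Y) = u∉Y (subst (_∈ Y) y≡u y∈Y)
    unshared u _ _ (inj₂ uy)  | inj₁ (u∈X , u∉Y) = rest-isolated u∈X u∉Y (Y⊆X y∈Y) uy
    unshared u _ u≢fy y∈N[u]  | inj₂ (y′ , y′∈Y , refl) =
      u≢fy (cong f (sym (f-private y′∈Y (Y⊆X y∈Y) (closedNbhd-sym G y∈N[u]))))

  flip-irredundant : Irredundant G X′
  flip-irredundant w w∈X′ with Equivalence.to (X′-members w) w∈X′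
  ... | inj₁ (w∈X , w∉Y)       = w , kept-self-private w∈X w∉Y
  ... | inj₂ (y , y∈Y , refl) = y , source-private y∈Y

  flip : Fin n → Fin n
  flip v with v ∈? Y
  ... | yes _ = f v
  ... | no  _ = v

  flip-maps : ∀ {v} → v ∈ X → flip v ∈ X′
  flip-maps {v} v∈X with v ∈? Y
  ... | yes v∈Y = Equivalence.from (X′-members (f v)) (inj₂ (v , v∈Y , refl))
  ... | no  v∉Y = Equivalence.from (X′-members v) (inj₁ (v∈X , v∉Y))

  -- Injectivity on X: f is injective on Y because distinct members of X have
  -- distinct private neighbours, and f(Y) is disjoint from X.
  flip-injective : ∀ {a b} → a ∈ X → b ∈ X → flip a ≡ flip b → a ≡ b
  flip-injective {a} {b} a∈X b∈X fa≡fb with a ∈? Y | b ∈? Y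
  ... | yes a∈Y | yes b∈Y =
    sym (f-private a∈Y b∈X (subst (λ w → InClosedNbhd G w b) (sym fa≡fb)
                              (inj₂ (f-adj b∈Y))))
  ... | yes a∈Y | no  _   = ⊥-elim (f-outside a∈Y (subst (_∈ X) (sym fa≡fb) b∈X))
  ... | no  _   | yes b∈Y = ⊥-elim (f-outside b∈Y (subst (_∈ X) fa≡fb a∈X))
  ... | no  _   | no  _   = fa≡fb

  flip-IRSet : IRSet G X → IRSet G X′
  flip-IRSet X-IR = IRSet-of-size≥ G X-IR flip-irredundant
    (injection-size X X′ flip flip-maps flip-injective)

proposition2p2 : {n : ℕ} (G : Graph n) (X Y Z : Subset n)
    → IRSet G X
    → (∀ v → v ∈ X ⇔ (v ∈ Y ⊎ v ∈ Z))
    → (∀ v → ¬ (v ∈ Y × v ∈ Z))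
    → (∀ z → z ∈ Z → ∀ x → x ∈ X → ¬ Adj G z x)
    → (∀ y → y ∈ Y → ∃ λ w → InEPN G y X w)
    → (f : Fin n → Fin n)
    → (∀ y → y ∈ Y → InEPN G y X (f y))
    → (X′ : Subset n)
    → (∀ w → w ∈ X′ ⇔ ((w ∈ X × w ∉ Y) ⊎ (∃ λ y → y ∈ Y × f y ≡ w)))
    → IRSet G X′
proposition2p2 G X Y Z X-IR partition _ Z-isolated _ f f-EPN X′ X′-members =
  Flip.flip-IRSet G X Y f Y⊆X rest-isolated (f-EPN _) X′ X′-members X-IR
  where
  Y⊆X : ∀ {y} → y ∈ Y → y ∈ X
  Y⊆X y∈Y = Equivalence.from (partition _) (inj₁ y∈Y)

  rest-isolated : ∀ {v} → v ∈ X → v ∉ Y → IsolatedIn G X v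
  rest-isolated {v} v∈X v∉Y with Equivalence.to (partition v) v∈X
  ... | inj₁ v∈Y = ⊥-elim (v∉Y v∈Y)
  ... | inj₂ v∈Z = Z-isolated v v∈Z _
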